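{- Let $n\ge1$ and $k\ge1$ be integers. There are coefficients $c^{(k)}_L$, indexed by $L=(l_1,\dots,l_n)$ with $1\le l_i\le k$, such that \[ (x_1x_2\cdots x_n)^{\underline{k}}=\sum_L c^{(k)}_L\, x_1^{\underline{l_1}}x_2^{\underline{l_2}}\cdots x_n^{\underline{l_n}}, \] and they are given by \[ c^{(k)}_L=\sum_{p=1}^k (-1)^{k-p}\begin{bmatrix} k\\ p\end{bmatrix}\prod_{i=1}^n\begin{Bmatrix} p\\ l_i\end{Bmatrix}. \]
   Context: $x^{\underline{n}}=x(x-1)\cdots(x-n+1)$ is the falling factorial power. $\begin{bmatrix} k\\ p\end{bmatrix}$ is the unsigned Stirling number of the first kind (permutations of $k$ letters with $p$ cycles) and $\begin{Bmatrix} p\\ l\end{Bmatrix}$ the Stirling number of the second kind (partitions of a $p$-set into $l$ nonempty blocks), both zero when the lower index exceeds the upper. -}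

module Defs where

open import Data.Nat as ℕ using (ℕ; zero; suc)
open import Data.Integer as ℤ using (ℤ; +_; -_)
open import Data.Fin using (Fin; toℕ)
open import Data.Fin as Fin using ()
import Data.Vec.Functional as VF

fall : ℤ → ℕ → ℤ
fall x zero    = + 1
fall x (suc n) = x ℤ.* fall (x ℤ.- + 1) n

stirling1 : ℕ → ℕ → ℕ
stirling1 zero    zero    = 1
stirling1 zero    (suc p) = 0
stirling1 (suc k) zero    = 0
stirling1 (suc k) (suc p) = k ℕ.* stirling1 k (suc p) ℕ.+ stirling1 k p

stirling2 : ℕ → ℕ → ℕ
stirling2 zero    zero    = 1
stirling2 zero    (suc l) = 0
stirling2 (suc p) zero    = 0
stirling2 (suc p) (suc l) = suc l ℕ.* stirling2 p (suc l) ℕ.+ stirling2 p l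

sumFin : (n : ℕ) → (Fin n → ℤ) → ℤ
sumFin zero    f = + 0
sumFin (suc n) f = f Fin.zero ℤ.+ sumFin n (λ i → f (Fin.suc i))

prodFin : (n : ℕ) → (Fin n → ℤ) → ℤ
prodFin zero    f = + 1
prodFin (suc n) f = f Fin.zero ℤ.* prodFin n (λ i → f (Fin.suc i))

sumFun : (n k : ℕ) → ((Fin n → Fin k) → ℤ) → ℤ
sumFun zero    k f = f (λ ())
sumFun (suc n) k f = sumFin k (λ j → sumFun n k (λ L → f (j VF.∷ L)))

sumFrom1 : ℕ → (ℕ → ℤ) → ℤ
sumFrom1 zero    f = + 0
sumFrom1 (suc k) f = sumFrom1 k f ℤ.+ f (suc k)

-- an index L = (l_1,…,l_n) with 1 ≤ l_i ≤ k is encoded as L : Fin n → Fin k,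
-- with  l_i = 1 + toℕ (L i)
ell : {n k : ℕ} → (Fin n → Fin k) → Fin n → ℕ
ell L i = suc (toℕ (L i))

coeff : (n k : ℕ) → (Fin n → Fin k) → ℤ
coeff n k L = sumFrom1 k (λ p →
  ((- + 1) ℤ.^ (k ℕ.∸ p)) ℤ.* (+ stirling1 k p) ℤ.*
    prodFin n (λ i → + stirling2 p (ell L i)))

-- Over ℤ one has y ^ p = Σₗ {p l} y^{\underline l} and y^{\underline k} = Σₚ s(k,p) y ^ p, with
-- s(k,p) = (-1)^{k-p} [k p] the signed Stirling numbers of the first kind; both follow from the
-- recurrences by an index shift. For y = x₁ ⋯ xₙ this gives
-- y^{\underline k} = Σₚ s(k,p) Πᵢ xᵢ ^ p = Σₚ s(k,p) Πᵢ Σ_{lᵢ} {p lᵢ} xᵢ^{\underline lᵢ};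
-- expanding the product of sums and exchanging the p-sum with the sum over L gives the formula.
-- The terms p = 0 and lᵢ = 0 drop out since [k 0] = 0 for k ≥ 1 and {p 0} = 0 for p ≥ 1.
module Submission where

open import Defs
open import Data.Nat using (ℕ; _≥_)
open import Data.Integer using (ℤ; _*_)
open import Data.Fin using (Fin)
open import Relation.Binary.PropositionalEquality using (_≡_)

open import Data.Nat as ℕ using (zero; suc; _<_; _≤_; _∸_; s≤s)
import Data.Nat.Properties as ℕP
open import Data.Integer using (+_; -_; _+_; _-_; _^_)
import Data.Integer.Properties as ℤP
open import Data.Integer.Tactic.RingSolver using (solve-∀)
open import Data.Fin using (toℕ; zero; suc)
open import Data.Fin.Properties using (toℕ<n)
import Data.Vec.Functional as Vector
open import Function using (_∘_)
open import Relation.Binary.PropositionalEquality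
  using (refl; sym; trans; cong; cong₂; module ≡-Reasoning)
open import Relation.Nullary using (yes; no)
open import Algebra.Properties.Semiring.Sum ℤP.+-*-semiring
  using (sum; sum-syntax; sum-cong-≗; sum-replicate-zero; ∑-distrib-+; ∑-comm;
         *-distribˡ-sum; *-distribʳ-sum)

open ≡-Reasoning

sumBelow : ℕ → (ℕ → ℤ) → ℤ
sumBelow N f = ∑[ i < N ] f (toℕ i)

sumBelow-cong : ∀ N {f g : ℕ → ℤ} → (∀ l → l < N → f l ≡ g l) →
                sumBelow N f ≡ sumBelow N g
sumBelow-cong N f≡g = sum-cong-≗ {N} (λ i → f≡g (toℕ i) (toℕ<n i))

sumBelow-+ : ∀ N (f g : ℕ → ℤ) → sumBelow N (λ l → f l + g l) ≡ sumBelow N f + sumBelow N g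
sumBelow-+ N f g = ∑-distrib-+ {N} (f ∘ toℕ) (g ∘ toℕ)

*-distribˡ-sumBelow : ∀ N c (f : ℕ → ℤ) → c * sumBelow N f ≡ sumBelow N (λ l → c * f l)
*-distribˡ-sumBelow N c f = *-distribˡ-sum {N} c (f ∘ toℕ)

*-distribʳ-sumBelow : ∀ N c (f : ℕ → ℤ) → sumBelow N f * c ≡ sumBelow N (λ l → f l * c)
*-distribʳ-sumBelow N c f = *-distribʳ-sum {N} c (f ∘ toℕ)

sumBelow-last : ∀ N f → sumBelow (suc N) f ≡ sumBelow N f + f N
sumBelow-last zero    f = trans (ℤP.+-identityʳ (f 0)) (sym (ℤP.+-identityˡ (f 0)))
sumBelow-last (suc N) f = begin
  f 0 + sumBelow (suc N) (f ∘ suc)     ≡⟨ cong (λ t → f 0 + t) (sumBelow-last N (f ∘ suc)) ⟩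
  f 0 + (sumBelow N (f ∘ suc) + f (suc N)) ≡⟨ sym (ℤP.+-assoc (f 0) _ _) ⟩
  f 0 + sumBelow N (f ∘ suc) + f (suc N) ∎

sumBelow-dropHead : ∀ N f → f 0 ≡ + 0 → sumBelow (suc N) f ≡ sumBelow N (f ∘ suc)
sumBelow-dropHead N f f0≡0 =
  trans (cong (_+ sumBelow N (f ∘ suc)) f0≡0) (ℤP.+-identityˡ _)

sumBelow-dropLast : ∀ N f → f N ≡ + 0 → sumBelow (suc N) f ≡ sumBelow N f
sumBelow-dropLast N f fN≡0 =
  trans (sumBelow-last N f) (trans (cong (λ t → sumBelow N f + t) fN≡0) (ℤP.+-identityʳ _))

sumBelow-single : ∀ N f → (∀ l → f (suc l) ≡ + 0) → sumBelow (suc N) f ≡ f 0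
sumBelow-single N f f⁺≡0 = begin
  f 0 + sumBelow N (f ∘ suc) ≡⟨ cong (λ t → f 0 + t) (sum-cong-≗ {N} (f⁺≡0 ∘ toℕ)) ⟩
  f 0 + sum (Vector.replicate N (+ 0)) ≡⟨ cong (λ t → f 0 + t) (sum-replicate-zero N) ⟩
  f 0 + + 0 ≡⟨ ℤP.+-identityʳ (f 0) ⟩
  f 0 ∎

sumFrom1≡sumBelow : ∀ N f → sumFrom1 N f ≡ sumBelow N (f ∘ suc)
sumFrom1≡sumBelow zero    f = refl
sumFrom1≡sumBelow (suc N) f =
  trans (cong (_+ f (suc N)) (sumFrom1≡sumBelow N f)) (sym (sumBelow-last N (f ∘ suc)))

-- The index shift that turns each Stirling recurrence into the next expansion.
sumBelow-shift : ∀ N (a b c e : ℕ → ℤ) → a N ≡ + 0 → b 0 ≡ + 0 → c 0 ≡ + 0 →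
                 (∀ l → c (suc l) ≡ a l + b (suc l)) →
                 sumBelow (suc N) (λ l → a l * e (suc l) + b l * e l) ≡
                 sumBelow (suc N) (λ l → c l * e l)
sumBelow-shift N a b c e aN≡0 b0≡0 c0≡0 c-rec = begin
  sumBelow (suc N) (λ l → a l * e (suc l) + b l * e l)
    ≡⟨ sumBelow-+ (suc N) (λ l → a l * e (suc l)) (λ l → b l * e l) ⟩
  sumBelow (suc N) (λ l → a l * e (suc l)) + sumBelow (suc N) (λ l → b l * e l)
    ≡⟨ cong₂ _+_ (sumBelow-dropLast N (λ l → a l * e (suc l)) (vanishes aN≡0))
                 (sumBelow-dropHead N (λ l → b l * e l) (vanishes b0≡0)) ⟩
  sumBelow N (λ l → a l * e (suc l)) + sumBelow N (λ l → b (suc l) * e (suc l))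
    ≡⟨ sym (sumBelow-+ N (λ l → a l * e (suc l)) (λ l → b (suc l) * e (suc l))) ⟩
  sumBelow N (λ l → a l * e (suc l) + b (suc l) * e (suc l))
    ≡⟨ sumBelow-cong N (λ l _ → trans (sym (ℤP.*-distribʳ-+ (e (suc l)) (a l) _))
                                      (cong (_* e (suc l)) (sym (c-rec l)))) ⟩
  sumBelow N (λ l → c (suc l) * e (suc l))
    ≡⟨ sym (sumBelow-dropHead N (λ l → c l * e l) (vanishes c0≡0)) ⟩
  sumBelow (suc N) (λ l → c l * e l) ∎
  where
  vanishes : ∀ {u v} → u ≡ + 0 → u * v ≡ + 0
  vanishes {v = v} refl = ℤP.*-zeroˡ v

sumFin≡sum : ∀ n (f : Fin n → ℤ) → sumFin n f ≡ sum f
sumFin≡sum zero    f = refl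
sumFin≡sum (suc n) f = cong (λ t → f zero + t) (sumFin≡sum n (f ∘ suc))

prodFin-cong : ∀ n {f g : Fin n → ℤ} → (∀ i → f i ≡ g i) → prodFin n f ≡ prodFin n g
prodFin-cong zero    f≡g = refl
prodFin-cong (suc n) f≡g = cong₂ _*_ (f≡g zero) (prodFin-cong n (f≡g ∘ suc))

interchange-* : ∀ (a b c d : ℤ) → a * b * (c * d) ≡ a * c * (b * d)
interchange-* = solve-∀

prodFin-distrib-* : ∀ n (f g : Fin n → ℤ) →
                    prodFin n (λ i → f i * g i) ≡ prodFin n f * prodFin n g
prodFin-distrib-* zero    f g = refl
prodFin-distrib-* (suc n) f g =
  trans (cong (f zero * g zero *_) (prodFin-distrib-* n (f ∘ suc) (g ∘ suc)))
        (interchange-* (f zero) (g zero) _ _)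

^-distribʳ-* : ∀ (a b : ℤ) p → (a * b) ^ p ≡ a ^ p * b ^ p
^-distribʳ-* a b zero    = refl
^-distribʳ-* a b (suc p) =
  trans (cong (a * b *_) (^-distribʳ-* a b p)) (interchange-* a b _ _)

prodFin-^ : ∀ n (x : Fin n → ℤ) p → prodFin n x ^ p ≡ prodFin n (λ i → x i ^ p)
prodFin-^ zero    x p = ℤP.^-zeroˡ p
prodFin-^ (suc n) x p =
  trans (^-distribʳ-* (x zero) _ p) (cong (x zero ^ p *_) (prodFin-^ n (x ∘ suc) p))

sumFin-cong : ∀ k {f g : Fin k → ℤ} → (∀ j → f j ≡ g j) → sumFin k f ≡ sumFin k g
sumFin-cong k {f} {g} f≡g = trans (sumFin≡sum k f) (trans (sum-cong-≗ f≡g) (sym (sumFin≡sum k g)))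

sumFun-cong : ∀ n k {f g : (Fin n → Fin k) → ℤ} → (∀ L → f L ≡ g L) →
              sumFun n k f ≡ sumFun n k g
sumFun-cong zero    k f≡g = f≡g _
sumFun-cong (suc n) k f≡g = sumFin-cong k (λ j → sumFun-cong n k (λ L → f≡g (j Vector.∷ L)))

*-distribˡ-sumFun : ∀ n k c (f : (Fin n → Fin k) → ℤ) →
                    c * sumFun n k f ≡ sumFun n k (λ L → c * f L)
*-distribˡ-sumFun zero    k c f = refl
*-distribˡ-sumFun (suc n) k c f = begin
  c * sumFin k g                       ≡⟨ cong (c *_) (sumFin≡sum k g) ⟩
  c * sum g                            ≡⟨ *-distribˡ-sum c g ⟩
  sum (λ j → c * g j)                  ≡⟨ sym (sumFin≡sum k _) ⟩
  sumFin k (λ j → c * g j)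
    ≡⟨ sumFin-cong k (λ j → *-distribˡ-sumFun n k c (λ L → f (j Vector.∷ L))) ⟩
  sumFun (suc n) k (λ L → c * f L)     ∎
  where
  g : Fin k → ℤ
  g j = sumFun n k (λ L → f (j Vector.∷ L))

∑-sumFun-comm : ∀ m n k (G : Fin m → (Fin n → Fin k) → ℤ) →
                ∑[ i < m ] sumFun n k (G i) ≡ sumFun n k (λ L → ∑[ i < m ] G i L)
∑-sumFun-comm m zero    k G = refl
∑-sumFun-comm m (suc n) k G = begin
  ∑[ i < m ] sumFin k (λ j → H i j)    ≡⟨ sum-cong-≗ (λ i → sumFin≡sum k (H i)) ⟩
  ∑[ i < m ] ∑[ j < k ] H i j          ≡⟨ ∑-comm H ⟩
  ∑[ j < k ] ∑[ i < m ] H i j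
    ≡⟨ sum-cong-≗ (λ j → ∑-sumFun-comm m n k (λ i L → G i (j Vector.∷ L))) ⟩
  ∑[ j < k ] sumFun n k (λ L → ∑[ i < m ] G i (j Vector.∷ L)) ≡⟨ sym (sumFin≡sum k _) ⟩
  sumFun (suc n) k (λ L → ∑[ i < m ] G i L) ∎
  where
  H : Fin m → Fin k → ℤ
  H i j = sumFun n k (λ L → G i (j Vector.∷ L))

prodFin-sumFin : ∀ n k (h : Fin n → Fin k → ℤ) →
                 prodFin n (λ i → sumFin k (h i)) ≡ sumFun n k (λ L → prodFin n (λ i → h i (L i)))
prodFin-sumFin zero    k h = refl
prodFin-sumFin (suc n) k h = begin
  sumFin k (h zero) * P            ≡⟨ cong (_* P) (sumFin≡sum k (h zero)) ⟩
  sum (h zero) * P                 ≡⟨ *-distribʳ-sum P (h zero) ⟩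
  ∑[ j < k ] (h zero j * P)        ≡⟨ sym (sumFin≡sum k _) ⟩
  sumFin k (λ j → h zero j * P)
    ≡⟨ sumFin-cong k (λ j → trans (cong (h zero j *_) (prodFin-sumFin n k (h ∘ suc)))
                                  (*-distribˡ-sumFun n k (h zero j) _)) ⟩
  sumFun (suc n) k (λ L → prodFin (suc n) (λ i → h i (L i))) ∎
  where
  P : ℤ
  P = prodFin n (λ i → sumFin k (h (suc i)))

fall-sucʳ : ∀ k y → fall y (suc k) ≡ fall y k * (y - + k)
fall-sucʳ zero    y = trans (ℤP.*-identityʳ y) (sym (trans (ℤP.*-identityˡ _) (ℤP.+-identityʳ y)))
fall-sucʳ (suc k) y = begin
  y * fall (y - + 1) (suc k)               ≡⟨ cong (y *_) (fall-sucʳ k (y - + 1)) ⟩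
  y * (fall (y - + 1) k * (y - + 1 - + k)) ≡⟨ regroup y (fall (y - + 1) k) (+ k) ⟩
  y * fall (y - + 1) k * (y - + suc k)     ∎
  where
  regroup : ∀ (y f m : ℤ) → y * (f * (y - + 1 - m)) ≡ y * f * (y - (+ 1 + m))
  regroup = solve-∀

*-fall : ∀ l y → y * fall y l ≡ fall y (suc l) + + l * fall y l
*-fall l y = begin
  y * fall y l                         ≡⟨ split y (fall y l) (+ l) ⟩
  fall y l * (y - + l) + + l * fall y l ≡⟨ cong (_+ + l * fall y l) (sym (fall-sucʳ l y)) ⟩
  fall y (suc l) + + l * fall y l      ∎
  where
  split : ∀ (y f m : ℤ) → y * f ≡ f * (y - m) + m * f
  split = solve-∀

stirling1-vanishes : ∀ k p → k < p → stirling1 k p ≡ 0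
stirling1-vanishes zero    (suc p) _       = refl
stirling1-vanishes (suc k) (suc p) (s≤s k<p)
  rewrite stirling1-vanishes k (suc p) (ℕP.m<n⇒m<1+n k<p) | stirling1-vanishes k p k<p =
  trans (ℕP.+-identityʳ _) (ℕP.*-zeroʳ k)

stirling2-vanishes : ∀ p l → p < l → stirling2 p l ≡ 0
stirling2-vanishes zero    (suc l) _       = refl
stirling2-vanishes (suc p) (suc l) (s≤s p<l)
  rewrite stirling2-vanishes p (suc l) (ℕP.m<n⇒m<1+n p<l) | stirling2-vanishes p l p<l =
  trans (ℕP.+-identityʳ _) (ℕP.*-zeroʳ (suc l))

pos-linear : ∀ m a b → + (m ℕ.* a ℕ.+ b) ≡ + m * + a + + b
pos-linear m a b = trans (ℤP.pos-+ (m ℕ.* a) b) (cong (_+ + b) (ℤP.pos-* m a))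

stirling2-rec : ∀ p l → + stirling2 (suc p) (suc l) ≡ + stirling2 p l + + suc l * + stirling2 p (suc l)
stirling2-rec p l =
  trans (pos-linear (suc l) (stirling2 p (suc l)) _) (ℤP.+-comm (+ suc l * + stirling2 p (suc l)) _)

pow-as-falls : ∀ p N y → p < N → y ^ p ≡ sumBelow N (λ l → + stirling2 p l * fall y l)
pow-as-falls zero    (suc N) y _ =
  sym (sumBelow-single N (λ l → + stirling2 0 l * fall y l) (λ l → ℤP.*-zeroˡ (fall y (suc l))))
pow-as-falls (suc p) (suc N) y (s≤s p<N) = begin
  y * y ^ p
    ≡⟨ cong (y *_) (pow-as-falls p (suc N) y (ℕP.m<n⇒m<1+n p<N)) ⟩
  y * sumBelow (suc N) (λ l → S p l * fall y l)
    ≡⟨ *-distribˡ-sumBelow (suc N) y (λ l → S p l * fall y l) ⟩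
  sumBelow (suc N) (λ l → y * (S p l * fall y l))
    ≡⟨ sumBelow-cong (suc N) (λ l _ → *-fall-scaled (S p l) l) ⟩
  sumBelow (suc N) (λ l → S p l * fall y (suc l) + + l * S p l * fall y l)
    ≡⟨ sumBelow-shift N (S p) (λ l → + l * S p l) (S (suc p)) (fall y)
                        (cong +_ (stirling2-vanishes p N p<N)) refl refl (stirling2-rec p) ⟩
  sumBelow (suc N) (λ l → S (suc p) l * fall y l)      ∎
  where
  S : ℕ → ℕ → ℤ
  S q l = + stirling2 q l
  *-fall-scaled : ∀ s l → y * (s * fall y l) ≡ s * fall y (suc l) + + l * s * fall y l
  *-fall-scaled s l = begin
    y * (s * fall y l)                         ≡⟨ left-comm y s _ ⟩
    s * (y * fall y l)                         ≡⟨ cong (s *_) (*-fall l y) ⟩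
    s * (fall y (suc l) + + l * fall y l)      ≡⟨ distribute s _ (+ l) _ ⟩
    s * fall y (suc l) + + l * s * fall y l    ∎
    where
    left-comm : ∀ (a b c : ℤ) → a * (b * c) ≡ b * (a * c)
    left-comm = solve-∀
    distribute : ∀ (s a m b : ℤ) → s * (a + m * b) ≡ s * a + m * s * b
    distribute = solve-∀

-- Defined by the closed form appearing in the coefficient, so that no separate sign lemma is needed.
signedStirling1 : ℕ → ℕ → ℤ
signedStirling1 k p = (- + 1) ^ (k ∸ p) * + stirling1 k p

signedStirling1-vanishes : ∀ k p → k < p → signedStirling1 k p ≡ + 0
signedStirling1-vanishes k p k<p =
  trans (cong (λ t → (- + 1) ^ (k ∸ p) * + t) (stirling1-vanishes k p k<p)) (ℤP.*-zeroʳ ((- + 1) ^ (k ∸ p)))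

signedStirling1-suc-zero : ∀ k → signedStirling1 (suc k) 0 ≡ + 0
signedStirling1-suc-zero k = ℤP.*-zeroʳ ((- + 1) ^ suc k)

-- When k ≤ p both sides vanish; otherwise k ∸ p = 1 + (k ∸ (p + 1)).
sign-flip : ∀ k p → (- + 1) ^ (k ∸ p) * + stirling1 k (suc p) ≡
                    - ((- + 1) ^ (k ∸ suc p) * + stirling1 k (suc p))
sign-flip k p with p ℕ.<? k
... | yes p<k = begin
  (- + 1) ^ (k ∸ p) * S              ≡⟨ cong (λ e → (- + 1) ^ e * S) (ℕP.+-∸-assoc 1 p<k) ⟩
  (- + 1) * (- + 1) ^ (k ∸ suc p) * S ≡⟨ negate ((- + 1) ^ (k ∸ suc p)) S ⟩
  - ((- + 1) ^ (k ∸ suc p) * S)      ∎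
  where
  S : ℤ
  S = + stirling1 k (suc p)
  negate : ∀ (e s : ℤ) → (- + 1) * e * s ≡ - (e * s)
  negate = solve-∀
... | no p≮k rewrite stirling1-vanishes k (suc p) (s≤s (ℕP.≮⇒≥ p≮k)) =
  trans (ℤP.*-zeroʳ ((- + 1) ^ (k ∸ p))) (sym (cong -_ (ℤP.*-zeroʳ ((- + 1) ^ (k ∸ suc p)))))

signedStirling1-rec : ∀ k p → signedStirling1 (suc k) (suc p) ≡
                              signedStirling1 k p + (- + k) * signedStirling1 k (suc p)
signedStirling1-rec k p = begin
  E * + (k ℕ.* stirling1 k (suc p) ℕ.+ stirling1 k p) ≡⟨ cong (E *_) (pos-linear k _ _) ⟩
  E * (+ k * S′ + S)                                  ≡⟨ expand E S S′ (+ k) ⟩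
  E * S + + k * (E * S′)
    ≡⟨ cong (λ t → E * S + + k * t) (sign-flip k p) ⟩
  E * S + + k * - ((- + 1) ^ (k ∸ suc p) * S′)         ≡⟨ move-sign (E * S) (+ k) _ ⟩
  E * S + (- + k) * ((- + 1) ^ (k ∸ suc p) * S′)       ∎
  where
  E S S′ : ℤ
  E  = (- + 1) ^ (k ∸ p)
  S  = + stirling1 k p
  S′ = + stirling1 k (suc p)
  expand : ∀ (e s s′ m : ℤ) → e * (m * s′ + s) ≡ e * s + m * (e * s′)
  expand = solve-∀
  move-sign : ∀ (a m b : ℤ) → a + m * - b ≡ a + (- m) * b
  move-sign = solve-∀

fall-as-pows : ∀ k N y → k < N → fall y k ≡ sumBelow N (λ p → signedStirling1 k p * y ^ p)
fall-as-pows zero    (suc N) y _ =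
  sym (sumBelow-single N (λ p → signedStirling1 0 p * y ^ p) (λ p → ℤP.*-zeroˡ (y ^ suc p)))
fall-as-pows (suc k) (suc N) y (s≤s k<N) = begin
  fall y (suc k)                                 ≡⟨ fall-sucʳ k y ⟩
  fall y k * (y - + k)
    ≡⟨ cong (_* (y - + k)) (fall-as-pows k (suc N) y (ℕP.m<n⇒m<1+n k<N)) ⟩
  sumBelow (suc N) (λ p → s k p * y ^ p) * (y - + k)
    ≡⟨ *-distribʳ-sumBelow (suc N) (y - + k) (λ p → s k p * y ^ p) ⟩
  sumBelow (suc N) (λ p → s k p * y ^ p * (y - + k))
    ≡⟨ sumBelow-cong (suc N) (λ p _ → split (s k p) (y ^ p) y (+ k)) ⟩
  sumBelow (suc N) (λ p → s k p * y ^ suc p + (- + k) * s k p * y ^ p)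
    ≡⟨ sumBelow-shift N (s k) (λ p → (- + k) * s k p) (s (suc k)) (y ^_)
                        (signedStirling1-vanishes k N k<N) (k-multiple k)
                        (signedStirling1-suc-zero k) (signedStirling1-rec k) ⟩
  sumBelow (suc N) (λ p → s (suc k) p * y ^ p)   ∎
  where
  s : ℕ → ℕ → ℤ
  s = signedStirling1
  split : ∀ (c w y m : ℤ) → c * w * (y - m) ≡ c * (y * w) + (- m) * c * w
  split = solve-∀
  k-multiple : ∀ k → (- + k) * s k 0 ≡ + 0
  k-multiple zero    = refl
  k-multiple (suc k) = trans (cong ((- + suc k) *_) (signedStirling1-suc-zero k)) (ℤP.*-zeroʳ (- + suc k))

pow-as-positive-falls : ∀ p k y → suc p ≤ k →
  y ^ suc p ≡ sumFin k (λ j → + stirling2 (suc p) (suc (toℕ j)) * fall y (suc (toℕ j)))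
pow-as-positive-falls p k y p<k = begin
  y ^ suc p                                          ≡⟨ pow-as-falls (suc p) (suc k) y (s≤s p<k) ⟩
  sumBelow (suc k) (λ l → S l * fall y l)
    ≡⟨ sumBelow-dropHead k (λ l → S l * fall y l) refl ⟩
  sumBelow k (λ l → S (suc l) * fall y (suc l))      ≡⟨ sym (sumFin≡sum k _) ⟩
  sumFin k (λ j → S (suc (toℕ j)) * fall y (suc (toℕ j))) ∎
  where
  S : ℕ → ℤ
  S l = + stirling2 (suc p) l

prodFin-pow-as-falls : ∀ n k (x : Fin n → ℤ) p → suc p ≤ k →
  prodFin n x ^ suc p ≡
    sumFun n k (λ L → prodFin n (λ i → + stirling2 (suc p) (ell L i)) *
                      prodFin n (λ i → fall (x i) (ell L i)))
prodFin-pow-as-falls n k x p p<k = begin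
  prodFin n x ^ suc p                                ≡⟨ prodFin-^ n x (suc p) ⟩
  prodFin n (λ i → x i ^ suc p)
    ≡⟨ prodFin-cong n (λ i → pow-as-positive-falls p k (x i) p<k) ⟩
  prodFin n (λ i → sumFin k (λ j → term i (suc (toℕ j))))
    ≡⟨ prodFin-sumFin n k (λ i j → term i (suc (toℕ j))) ⟩
  sumFun n k (λ L → prodFin n (λ i → term i (ell L i)))
    ≡⟨ sumFun-cong n k (λ L → prodFin-distrib-* n (λ i → + stirling2 (suc p) (ell L i)) _) ⟩
  sumFun n k (λ L → prodFin n (λ i → + stirling2 (suc p) (ell L i)) *
                    prodFin n (λ i → fall (x i) (ell L i))) ∎
  where
  term : Fin n → ℕ → ℤ
  term i l = + stirling2 (suc p) l * fall (x i) l

mainTheorem8 : (n k : ℕ) → n ≥ 1 → k ≥ 1 → (x : Fin n → ℤ) →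
    fall (prodFin n x) k ≡
      sumFun n k (λ L → coeff n k L * prodFin n (λ i → fall (x i) (ell L i)))
mainTheorem8 n k@(suc k′) _ _ x = begin
  fall y k                                      ≡⟨ fall-as-pows k (suc k) y (ℕP.n<1+n k) ⟩
  sumBelow (suc k) (λ p → s p * y ^ p)
    ≡⟨ sumBelow-dropHead k (λ p → s p * y ^ p) (cong (_* + 1) (signedStirling1-suc-zero k′)) ⟩
  sumBelow k (λ p → s (suc p) * y ^ suc p)      ≡⟨ sumBelow-cong k expand ⟩
  sumBelow k (λ p → sumFun n k (T p))           ≡⟨ ∑-sumFun-comm k n k (T ∘ toℕ) ⟩
  sumFun n k (λ L → sumBelow k (λ p → T p L))   ≡⟨ sumFun-cong n k collect ⟩
  sumFun n k (λ L → coeff n k L * PF L)         ∎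
  where
  y : ℤ
  y = prodFin n x
  s : ℕ → ℤ
  s = signedStirling1 k
  PS : ℕ → (Fin n → Fin k) → ℤ
  PS p L = prodFin n (λ i → + stirling2 p (ell L i))
  PF : (Fin n → Fin k) → ℤ
  PF L = prodFin n (λ i → fall (x i) (ell L i))
  T : ℕ → (Fin n → Fin k) → ℤ
  T p L = s (suc p) * (PS (suc p) L * PF L)
  expand : ∀ p → p < k → s (suc p) * y ^ suc p ≡ sumFun n k (T p)
  expand p p<k = trans (cong (s (suc p) *_) (prodFin-pow-as-falls n k x p p<k))
                       (*-distribˡ-sumFun n k (s (suc p)) (λ L → PS (suc p) L * PF L))
  collect : ∀ L → sumBelow k (λ p → T p L) ≡ coeff n k L * PF L
  collect L = begin
    sumBelow k (λ p → T p L)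
      ≡⟨ sumBelow-cong k (λ p _ → sym (ℤP.*-assoc (s (suc p)) (PS (suc p) L) (PF L))) ⟩
    sumBelow k (λ p → s (suc p) * PS (suc p) L * PF L)
      ≡⟨ sym (*-distribʳ-sumBelow k (PF L) (λ p → s (suc p) * PS (suc p) L)) ⟩
    sumBelow k (λ p → s (suc p) * PS (suc p) L) * PF L
      ≡⟨ cong (_* PF L) (sym (sumFrom1≡sumBelow k (λ p → s p * PS p L))) ⟩
    coeff n k L * PF L                                   ∎
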